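{- Let $\Sigma$ be a signature and $E$ an inequational axiomatization over $\Sigma$. Suppose that for each inequation $t\preccurlyeq u$ (between open $\Sigma$-terms) such that $E\vdash\sigma(t)\preccurlyeq\sigma(u)$ for every closed substitution $\sigma$, there exist a mapping $R:\mathrm{T}(\Sigma)\to\mathbb{T}(\Sigma)$ and a closed substitution $\rho$ such that: (1) $E\vdash t\preccurlyeq R(\rho(t))$ and $E\vdash R(\rho(u))\preccurlyeq u$; (2) $E\vdash R(\sigma(v))\preccurlyeq R(\sigma(w))$ for each axiom $v\preccurlyeq w\in E$ and each closed substitution $\sigma$; and (3) for each function symbol $f$ of $\Sigma$ with arity $n$ and all closed terms $p_1,\dots,p_n,q_1,\dots,q_n$: $E\cup\{p_i\preccurlyeq q_i,\ R(p_i)\preccurlyeq R(q_i)\mid i=1,\dots,n\}\vdash R(f(p_1,\dots,p_n))\preccurlyeq R(f(q_1,\dots,q_n))$. Then $E$ is $\omega$-complete.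
   Context: $\mathrm{T}(\Sigma)$ and $\mathbb{T}(\Sigma)$ denote the sets of closed and open terms over $\Sigma$ (open terms may contain variables from a countably infinite set). A closed substitution maps variables to closed terms. Inequational logic: $E\vdash t\preccurlyeq u$ if derivable by reflexivity, transitivity, substitution instances of axioms, and closure under contexts ($t_i\preccurlyeq u_i$ for $i=1..n$ implies $f(t_1,..,t_n)\preccurlyeq f(u_1,..,u_n)$). $E$ is $\omega$-complete if for all terms $t,u$ with $E\vdash\sigma(t)\preccurlyeq\sigma(u)$ for all closed substitutions $\sigma$, we have $E\vdash t\preccurlyeq u$. -}

module Defs where

open import Data.Nat using (ℕ)
open import Data.Fin using (Fin)
open import Data.Empty using (⊥; ⊥-elim)
open import Data.Sum using (_⊎_)
open import Data.Product using (∃; _×_)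
open import Relation.Binary.PropositionalEquality using (_≡_)

record Signature : Set₁ where
  field
    Sym   : Set
    arity : Sym → ℕ
open Signature public

module _ (Σ : Signature) where

  data Term (V : Set) : Set where
    var : V → Term V
    app : (f : Sym Σ) → (Fin (arity Σ f) → Term V) → Term V

Var : Set
Var = ℕ

-- 𝕋(Σ): open terms;  T(Σ): closed terms (no variables).
OTerm : Signature → Set
OTerm Σ = Term Σ Var

CTerm : Signature → Set
CTerm Σ = Term Σ ⊥

module _ {Σ : Signature} where

  subst : {V W : Set} → (V → Term Σ W) → Term Σ V → Term Σ W
  subst σ (var x)    = σ x
  subst σ (app f ts) = app f (λ i → subst σ (ts i))

  emb : CTerm Σ → OTerm Σ
  emb = subst (λ ())

  ClosedSubst : Set
  ClosedSubst = Var → CTerm Σ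

  csub : ClosedSubst → OTerm Σ → CTerm Σ
  csub σ t = subst σ t

Axioms : Signature → Set₁
Axioms Σ = OTerm Σ → OTerm Σ → Set

_∪_ : {Σ : Signature} → Axioms Σ → Axioms Σ → Axioms Σ
(E ∪ F) t u = E t u ⊎ F t u

data _⊢_≼_ {Σ : Signature} (E : Axioms Σ) : OTerm Σ → OTerm Σ → Set where
  refl≼  : ∀ {t} → E ⊢ t ≼ t
  trans≼ : ∀ {t u v} → E ⊢ t ≼ u → E ⊢ u ≼ v → E ⊢ t ≼ v
  axiom  : ∀ {v w} → E v w → (σ : Var → OTerm Σ) → E ⊢ subst σ v ≼ subst σ w
  ctx    : (f : Sym Σ) {ts us : Fin (arity Σ f) → OTerm Σ} →
           (∀ i → E ⊢ ts i ≼ us i) → E ⊢ app f ts ≼ app f us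

ωComplete : {Σ : Signature} → Axioms Σ → Set
ωComplete {Σ} E = ∀ (t u : OTerm Σ) →
  (∀ (σ : ClosedSubst {Σ}) → E ⊢ emb (csub σ t) ≼ emb (csub σ u)) →
  E ⊢ t ≼ u

ExtraHyps : {Σ : Signature} (R : CTerm Σ → OTerm Σ) {n : ℕ} →
            (p q : Fin n → CTerm Σ) → Axioms Σ
ExtraHyps R p q a b =
  ∃ λ i → (a ≡ emb (p i) × b ≡ emb (q i)) ⊎ (a ≡ R (p i) × b ≡ R (q i))

Fin′ : (Σ : Signature) → Sym Σ → Set
Fin′ Σ f = Fin (arity Σ f)

module Submission where

-- The heart of the proof is a
-- transfer lemma: conditions (2) and (3) make R monotone with respect to
-- derivability, i.e. every derivation E ⊢ a ≼ b yields
-- E ⊢ R(τ(a)) ≼ R(τ(b)) for each closed substitution τ.  This is shown by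
-- induction on the derivation: axiom instances are handled by (2) and
-- context steps by (3), after discharging the extra hypotheses of (3) by
-- derivations in E.  Instantiating it with the closed derivation
-- E ⊢ ρ(t) ≼ ρ(u) gives E ⊢ R(ρ(t)) ≼ R(ρ(u)), and condition (1) closes the
-- chain t ≼ R(ρ(t)) ≼ R(ρ(u)) ≼ u.
--
-- Terms carry their arguments as functions Fin n → Term, so, lacking
-- function extensionality, identities between terms are stated with a
-- syntactic equality _≈_.

open import Defs
open import Data.Product using (Σ-syntax; _×_; _,_)
open import Data.Sum using (inj₁; inj₂)
open import Data.Fin using (Fin)
open import Relation.Binary.PropositionalEquality using (refl)

module Syntax (S : Signature) where

  data _≈_ {V : Set} : Term S V → Term S V → Set where
    var≈ : ∀ x → var x ≈ var x
    app≈ : ∀ f {ts us : Fin (arity S f) → Term S V} →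
           (∀ i → ts i ≈ us i) → app f ts ≈ app f us

  ≈-refl : ∀ {V} (t : Term S V) → t ≈ t
  ≈-refl (var x)    = var≈ x
  ≈-refl (app f ts) = app≈ f (λ i → ≈-refl (ts i))

  ≈-sym : ∀ {V} {t u : Term S V} → t ≈ u → u ≈ t
  ≈-sym (var≈ x)   = var≈ x
  ≈-sym (app≈ f h) = app≈ f (λ i → ≈-sym (h i))

  subst-resp-≈ : ∀ {V W} (σ : V → Term S W) {t u : Term S V} →
                 t ≈ u → subst σ t ≈ subst σ u
  subst-resp-≈ σ (var≈ x)   = ≈-refl (σ x)
  subst-resp-≈ σ (app≈ f h) = app≈ f (λ i → subst-resp-≈ σ (h i))

  subst-subst : ∀ {U V W} (τ : V → Term S W) (σ : U → Term S V) (t : Term S U) →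
                subst τ (subst σ t) ≈ subst (λ x → subst τ (σ x)) t
  subst-subst τ σ (var x)    = ≈-refl (subst τ (σ x))
  subst-subst τ σ (app f ts) = app≈ f (λ i → subst-subst τ σ (ts i))

  csub-emb : (τ : ClosedSubst {S}) (p : CTerm S) → csub τ (emb p) ≈ p
  csub-emb τ (var ())
  csub-emb τ (app f ps) = app≈ f (λ i → csub-emb τ (ps i))

module Derivability (S : Signature) (E : Axioms S) where
  open Syntax S

  ≈⇒⊢ : {a b : OTerm S} → a ≈ b → E ⊢ a ≼ b
  ≈⇒⊢ (var≈ x)   = refl≼
  ≈⇒⊢ (app≈ f h) = ctx f (λ i → ≈⇒⊢ (h i))

  ⊢-subst : {a b : OTerm S} → E ⊢ a ≼ b →
            (σ : Var → OTerm S) → E ⊢ subst σ a ≼ subst σ b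
  ⊢-subst refl≼         σ = refl≼
  ⊢-subst (trans≼ d e)  σ = trans≼ (⊢-subst d σ) (⊢-subst e σ)
  ⊢-subst (ctx f h)     σ = ctx f (λ i → ⊢-subst (h i) σ)
  ⊢-subst (axiom {v} {w} ax σ₀) σ =
    trans≼ (≈⇒⊢ (subst-subst σ σ₀ v))
      (trans≼ (axiom ax (λ x → subst σ (σ₀ x)))
              (≈⇒⊢ (≈-sym (subst-subst σ σ₀ w))))

  ⊢-csub : {a b : OTerm S} → E ⊢ a ≼ b →
           (τ : ClosedSubst {S}) → E ⊢ emb (csub τ a) ≼ emb (csub τ b)
  ⊢-csub {a} {b} d τ =
    trans≼ (≈⇒⊢ (subst-subst (λ ()) τ a))
      (trans≼ (⊢-subst d (λ x → emb (τ x)))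
              (≈⇒⊢ (≈-sym (subst-subst (λ ()) τ b))))

  discharge : (F : Axioms S) →
              (∀ v w → F v w → ∀ σ → E ⊢ subst σ v ≼ subst σ w) →
              {a b : OTerm S} → F ⊢ a ≼ b → E ⊢ a ≼ b
  discharge F derivable refl≼        = refl≼
  discharge F derivable (trans≼ d e) =
    trans≼ (discharge F derivable d) (discharge F derivable e)
  discharge F derivable (axiom ax σ) = derivable _ _ ax σ
  discharge F derivable (ctx f h)    = ctx f (λ i → discharge F derivable (h i))

module Transfer (S : Signature) (E : Axioms S) (R : CTerm S → OTerm S)
  (preserves-axioms : ∀ (v w : OTerm S) → E v w → ∀ (σ : ClosedSubst {S}) →
                      E ⊢ R (csub σ v) ≼ R (csub σ w))
  (compatible : ∀ (f : Sym S) (p q : Fin′ S f → CTerm S) →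
                (E ∪ ExtraHyps R p q) ⊢ R (app f p) ≼ R (app f q))
  where
  open Syntax S
  open Derivability S E

  R-ctx : (f : Sym S) (p q : Fin′ S f → CTerm S) →
          (∀ i → E ⊢ emb (p i) ≼ emb (q i)) → (∀ i → E ⊢ R (p i) ≼ R (q i)) →
          E ⊢ R (app f p) ≼ R (app f q)
  R-ctx f p q p≼q Rp≼Rq = discharge _ extra-derivable (compatible f p q)
    where
    extra-derivable : ∀ v w → (E ∪ ExtraHyps R p q) v w →
                      ∀ σ → E ⊢ subst σ v ≼ subst σ w
    extra-derivable v w (inj₁ ax) σ                         = axiom ax σ
    extra-derivable v w (inj₂ (i , inj₁ (refl , refl))) σ = ⊢-subst (p≼q i) σ
    extra-derivable v w (inj₂ (i , inj₂ (refl , refl))) σ = ⊢-subst (Rp≼Rq i) σ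

  R-resp-≈ : {p q : CTerm S} → p ≈ q → E ⊢ R p ≼ R q
  R-resp-≈ (var≈ ())
  R-resp-≈ (app≈ f {ps} {qs} h) =
    R-ctx f ps qs (λ i → ≈⇒⊢ (subst-resp-≈ (λ ()) (h i))) (λ i → R-resp-≈ (h i))

  R-monotone : {a b : OTerm S} → E ⊢ a ≼ b →
               (τ : ClosedSubst {S}) → E ⊢ R (csub τ a) ≼ R (csub τ b)
  R-monotone refl≼        τ = refl≼
  R-monotone (trans≼ d e) τ = trans≼ (R-monotone d τ) (R-monotone e τ)
  R-monotone (axiom {v} {w} ax σ) τ =
    trans≼ (R-resp-≈ (subst-subst τ σ v))
      (trans≼ (preserves-axioms v w ax (λ x → csub τ (σ x)))
              (R-resp-≈ (≈-sym (subst-subst τ σ w))))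
  R-monotone (ctx f {ts} {us} h) τ =
    R-ctx f (λ i → csub τ (ts i)) (λ i → csub τ (us i))
      (λ i → ⊢-csub (h i) τ) (λ i → R-monotone (h i) τ)

  -- For closed terms: E ⊢ p ≼ q implies E ⊢ R(p) ≼ R(q).  Any closed
  -- substitution τ serves to ground the derivation's intermediate terms.
  R-monotone-closed : {p q : CTerm S} → E ⊢ emb p ≼ emb q →
                      ClosedSubst {S} → E ⊢ R p ≼ R q
  R-monotone-closed {p} {q} d τ =
    trans≼ (R-resp-≈ (≈-sym (csub-emb τ p)))
      (trans≼ (R-monotone d τ) (R-resp-≈ (csub-emb τ q)))

theorem6p1 : (S : Signature) (E : Axioms S) →
    (∀ (t u : OTerm S) →
      (∀ (σ : ClosedSubst {S}) → E ⊢ emb (csub σ t) ≼ emb (csub σ u)) →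
      Σ[ R ∈ (CTerm S → OTerm S) ] Σ[ ρ ∈ ClosedSubst {S} ]
        ((E ⊢ t ≼ R (csub ρ t)) × (E ⊢ R (csub ρ u) ≼ u))
        × (∀ (v w : OTerm S) → E v w → ∀ (σ : ClosedSubst {S}) →
             E ⊢ R (csub σ v) ≼ R (csub σ w))
        × (∀ (f : Sym S) (p q : Fin′ S f → CTerm S) →
             (E ∪ ExtraHyps R p q) ⊢ R (app f p) ≼ R (app f q))) →
    ωComplete E
theorem6p1 S E hyp t u closed-instances
  with hyp t u closed-instances
... | R , ρ , (t≼Rρt , Rρu≼u) , preserves-axioms , compatible =
  trans≼ t≼Rρt (trans≼ Rρt≼Rρu Rρu≼u)
  where
  open Transfer S E R preserves-axioms compatible
  Rρt≼Rρu : E ⊢ R (csub ρ t) ≼ R (csub ρ u)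
  Rρt≼Rρu = R-monotone-closed (closed-instances ρ) ρ
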